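{- Let $m\ge2$ and $\ell_1,\dots,\ell_m$ be positive integers with at most one $\ell_i$ equal to $1$, and let $G=\theta(\ell_1,\dots,\ell_m)$ have at least $5$ vertices. Then $G$ is prime if and only if $|\{i:\ell_i=2\}|\le1$.
   Context: Graphs are finite and simple. $\theta(\ell_1,\dots,\ell_m)$ is the graph with two specified vertices $x,y$ consisting of $m$ internally-disjoint paths from $x$ to $y$ of lengths $\ell_1,\dots,\ell_m$. A split of a graph is a partition $(A,B)$ of its vertex set with $\min\{|A|,|B|\}\ge2$ such that for some $A'\subseteq A$, $B'\subseteq B$, vertices $x\in A$, $y\in B$ are adjacent iff $x\in A'$ and $y\in B'$; a graph is prime if it has no split. -}

module Defs where

open import Data.Nat using (ℕ; zero; suc; _∸_; _+_; _≟_)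
open import Data.Fin using (Fin; toℕ)
open import Data.Bool using (Bool; true; false)
open import Data.List using (length; filter; map; allFin)
open import Data.Nat.ListAction using (sum)
open import Data.Product using (Σ; _×_; ∃; ∃-syntax)
open import Data.Sum using (_⊎_)
open import Relation.Binary.PropositionalEquality using (_≡_; _≢_)
open import Relation.Nullary using (¬_)
open import Function.Bundles using (_⇔_)

record Graph : Set₁ where
  field
    V   : Set
    Adj : V → V → Set
open Graph public

-- A split of G: a partition (A,B) of V (A as a characteristic function,
-- B = complement), both sides with at least two vertices, and subsets
-- A' ⊆ A, B' ⊆ B such that for a ∈ A, b ∈ B: a ~ b iff a ∈ A' and b ∈ B'.
record Split (G : Graph) : Set where
  field
    A  : V G → Bool
    A' : V G → Bool
    B' : V G → Bool
    a₁ a₂ b₁ b₂ : V G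
    a₁≢a₂ : a₁ ≢ a₂
    b₁≢b₂ : b₁ ≢ b₂
    a₁∈A : A a₁ ≡ true
    a₂∈A : A a₂ ≡ true
    b₁∈B : A b₁ ≡ false
    b₂∈B : A b₂ ≡ false
    A'⊆A : ∀ v → A' v ≡ true → A v ≡ true
    B'⊆B : ∀ v → B' v ≡ true → A v ≡ false
    cross : ∀ a b → A a ≡ true → A b ≡ false →
            Adj G a b ⇔ (A' a ≡ true × B' b ≡ true)

Prime : Graph → Set
Prime G = ¬ Split G

-- Vertices of θ(ℓ₁,…,ℓₘ): the two ends x, y and, for each path i,
-- the ℓᵢ - 1 internal vertices inner i j (j = 0,…,ℓᵢ-2).
data ThetaV (m : ℕ) (ℓ : Fin m → ℕ) : Set where
  vx : ThetaV m ℓ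
  vy : ThetaV m ℓ
  inner : (i : Fin m) → Fin (ℓ i ∸ 1) → ThetaV m ℓ

data OnPath {m : ℕ} {ℓ : Fin m → ℕ} (i : Fin m) : ThetaV m ℓ → ℕ → Set where
  onx : OnPath i vx 0
  ony : OnPath i vy (ℓ i)
  oninner : (j : Fin (ℓ i ∸ 1)) → OnPath i (inner i j) (suc (toℕ j))

ThetaAdj : (m : ℕ) (ℓ : Fin m → ℕ) → ThetaV m ℓ → ThetaV m ℓ → Set
ThetaAdj m ℓ u v = Σ (Fin m) λ i → Σ ℕ λ p →
  (OnPath i u p × OnPath i v (suc p)) ⊎ (OnPath i v p × OnPath i u (suc p))

θ : (m : ℕ) → (Fin m → ℕ) → Graph
θ m ℓ = record { V = ThetaV m ℓ ; Adj = ThetaAdj m ℓ }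

thetaOrder : (m : ℕ) → (Fin m → ℕ) → ℕ
thetaOrder m ℓ = 2 + sum (map (λ i → ℓ i ∸ 1) (allFin m))

countEq : (m : ℕ) → (Fin m → ℕ) → ℕ → ℕ
countEq m ℓ k = length (filter (λ i → ℓ i ≟ k) (allFin m))

{-# OPTIONS --safe #-}
module Submission where

-- If two paths have length 2, their middle vertices form one side of a split whose other side
-- sees them only through x and y.  Conversely, across a split (A, B) the edges form the complete
-- bipartite graph A' × B', while an interior vertex of θ has just its two path neighbours.  If x
-- and y lie in A, every vertex of B is interior, and the cut edges met on its path walking in from
-- x and from y must be its own two edges; two vertices of B then share both neighbours, which
-- happens only for the middles of two paths of length 2.  If x ∈ A and y ∈ B, cut edges at interior
-- vertices of A and of B lie on one path i and are adjacent; every other path is then a single edge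
-- xy with x ∈ A', y ∈ B', which forces ℓᵢ = 3, so θ has only four vertices.

open import Defs
open import Data.Bool using (Bool; true; false; not)
open import Data.Bool.Properties using (T-≡; not-injective)
open import Data.Empty using (⊥)
open import Data.Fin using (Fin; toℕ; fromℕ<; punchIn) renaming (zero to fzero; suc to fsuc)
open import Data.Fin.Properties using (toℕ<n; toℕ-fromℕ<; fromℕ<-toℕ; punchInᵢ≢i)
  renaming (_≟_ to _≟ᶠ_; suc-injective to fsuc-injective)
open import Data.List using (List; _∷_; length; filter; map; allFin; tabulate)
open import Data.List.Membership.Propositional using (_∈_)
open import Data.List.Membership.Propositional.Properties using (∈-allFin; ∈-filter⁺; ∈-filter⁻; ∈-length)
open import Data.List.Properties using (map-tabulate)
open import Data.List.Relation.Unary.AllPairs using (_∷_)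
open import Data.List.Relation.Unary.All using (_∷_)
open import Data.List.Relation.Unary.Any using (here; there)
open import Data.List.Relation.Unary.Unique.Propositional using (Unique)
open import Data.List.Relation.Unary.Unique.Propositional.Properties using (allFin⁺; filter⁺)
open import Data.Nat using (ℕ; zero; suc; _≤_; _<_; _∸_; _+_; z≤n; s≤s; _<?_; _≤?_; _≟_; _≡ᵇ_)
open import Data.Nat.ListAction using (sum)
open import Data.Nat.Properties
  using ( ≤-refl; ≤-trans; ≤-antisym; <-trans; <-asym; <⇒≤; <⇒≱; <⇒≢; ≰⇒>; ≮⇒≥; ≤-pred
        ; n≤1+n; n<1+n; n≮n; 1+n≰n; m≤n⇒m≤1+n; m<n⇒m<1+n; m≤n⇒m<n∨m≡n; n<1⇒n≡0
        ; +-identityʳ; +-cancelˡ-≡; m≢1+n+m; ≡⇒≡ᵇ; ≡ᵇ⇒≡ )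
open import Data.Product using (_×_; _,_; proj₁; proj₂; ∃-syntax; ∃₂; swap)
open import Data.Sum using (_⊎_; inj₁; inj₂)
import Data.Sum as Sum
open import Function using (_∘_)
open import Function.Bundles using (_⇔_; mk⇔; Equivalence)
open import Relation.Binary.PropositionalEquality
  using (_≡_; _≢_; refl; sym; trans; cong; subst; subst₂; ≢-sym; module ≡-Reasoning)
open import Relation.Nullary using (Dec; yes; no; contradiction)
open import Relation.Unary using (Pred; Decidable)

AtMostOne : ∀ {a p} {A : Set a} → Pred A p → Set _
AtMostOne P = ∀ {x y} → x ≢ y → P x → P y → ⊥

falling-edge : (f : ℕ → Bool) {p q : ℕ} → p ≤ q → f p ≡ true → f q ≡ false →
               ∃[ k ] p ≤ k × k < q × f k ≡ true × f (suc k) ≡ false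
falling-edge f {q = zero} z≤n fp fq = contradiction (trans (sym fp) fq) λ ()
falling-edge f {p} {suc q} p≤1+q fp fq with m≤n⇒m<n∨m≡n p≤1+q | f q in fq′
... | inj₂ refl | _     = contradiction (trans (sym fp) fq) λ ()
... | inj₁ p<1+q | true = q , ≤-pred p<1+q , n<1+n q , fq′ , fq
... | inj₁ p<1+q | false with falling-edge f (≤-pred p<1+q) fp fq′
...   | k , p≤k , k<q , fk , fk+1 = k , p≤k , m<n⇒m<1+n k<q , fk , fk+1

module _ {a} {A : Set a} where

  distinct-members⇒2≤length : ∀ {x y : A} {xs} → x ∈ xs → y ∈ xs → x ≢ y → 2 ≤ length xs
  distinct-members⇒2≤length (here refl) (here refl) x≢y = contradiction refl x≢y
  distinct-members⇒2≤length (here _)    (there y∈)  _   = s≤s (∈-length y∈)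
  distinct-members⇒2≤length (there x∈)  (here _)    _   = s≤s (∈-length x∈)
  distinct-members⇒2≤length (there x∈)  (there y∈)  x≢y = m≤n⇒m≤1+n (distinct-members⇒2≤length x∈ y∈ x≢y)

  2≤length⇒distinct-members : ∀ {xs : List A} → Unique xs → 2 ≤ length xs →
                              ∃₂ λ x y → x ∈ xs × y ∈ xs × x ≢ y
  2≤length⇒distinct-members {x ∷ y ∷ _} ((x≢y ∷ _) ∷ _) (s≤s (s≤s z≤n)) = x , y , here refl , there (here refl) , x≢y

  length-filter≤1⇔ : ∀ {p} {P : Pred A p} (P? : Decidable P) {xs} → Unique xs →
                     length (filter P? xs) ≤ 1 ⇔ AtMostOne (λ x → x ∈ xs × P x)
  length-filter≤1⇔ {P = P} P? {xs} unique = mk⇔ to from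
    where
    to : length (filter P? xs) ≤ 1 → AtMostOne (λ x → x ∈ xs × P x)
    to ≤1 x≢y (x∈ , px) (y∈ , py) =
      <⇒≱ (distinct-members⇒2≤length (∈-filter⁺ P? x∈ px) (∈-filter⁺ P? y∈ py) x≢y) ≤1
    from : AtMostOne (λ x → x ∈ xs × P x) → length (filter P? xs) ≤ 1
    from atMostOne with length (filter P? xs) ≤? 1
    ... | yes ≤1 = ≤1
    ... | no ≰1 with 2≤length⇒distinct-members (filter⁺ P? unique) (≰⇒> ≰1)
    ...   | x , y , x∈ , y∈ , x≢y = contradiction (∈-filter⁻ P? y∈) (atMostOne x≢y (∈-filter⁻ P? x∈))

count-allFin≤1⇔ : ∀ {n p} {P : Pred (Fin n) p} (P? : Decidable P) →
                  length (filter P? (allFin n)) ≤ 1 ⇔ AtMostOne P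
count-allFin≤1⇔ {n} P? = mk⇔ (λ ≤1 {x} {y} x≢y px py → Equivalence.to equiv ≤1 x≢y (∈-allFin x , px) (∈-allFin y , py))
                  (λ atMostOne → Equivalence.from equiv λ x≢y (_ , px) (_ , py) → atMostOne x≢y px py)
  where equiv = length-filter≤1⇔ P? (allFin⁺ n)

sum-tabulate-zero : ∀ {n} (g : Fin n → ℕ) → (∀ j → g j ≡ 0) → sum (tabulate g) ≡ 0
sum-tabulate-zero {zero}  g g≡0 = refl
sum-tabulate-zero {suc n} g g≡0 rewrite g≡0 fzero = sum-tabulate-zero (g ∘ fsuc) (g≡0 ∘ fsuc)

sum-tabulate-single : ∀ {n} (g : Fin n → ℕ) i → (∀ j → j ≢ i → g j ≡ 0) → sum (tabulate g) ≡ g i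
sum-tabulate-single g fzero g≡0
  rewrite sum-tabulate-zero (g ∘ fsuc) (λ j → g≡0 (fsuc j) λ ()) = +-identityʳ (g fzero)
sum-tabulate-single g (fsuc i) g≡0
  rewrite g≡0 fzero (λ ()) = sum-tabulate-single (g ∘ fsuc) i (λ j j≢i → g≡0 (fsuc j) (j≢i ∘ fsuc-injective))

other-index : ∀ {n} → 2 ≤ n → (i : Fin n) → ∃[ j ] j ≢ i
other-index (s≤s (s≤s _)) i = punchIn i fzero , punchInᵢ≢i i fzero

module _ {G : Graph} (S : Split G) where
  open Split S

  different-sides : ∀ {u v} → A u ≡ true → A v ≡ false → u ≢ v
  different-sides Au Av refl = contradiction (trans (sym Au) Av) λ ()

  cut-edge : ∀ {a b} → A a ≡ true → A b ≡ false → Adj G a b → A' a ≡ true × B' b ≡ true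
  cut-edge {a} {b} a∈A b∈B = Equivalence.to (cross a b a∈A b∈B)

  complete : ∀ {a b} → A' a ≡ true → B' b ≡ true → Adj G a b
  complete {a} {b} a∈A' b∈B' = Equivalence.from (cross a b (A'⊆A a a∈A') (B'⊆B b b∈B')) (a∈A' , b∈B')

  A-vertex-other-than : ∀ {v} → Dec (a₁ ≡ v) → ∃[ a ] A a ≡ true × a ≢ v
  A-vertex-other-than (yes refl) = a₂ , a₂∈A , a₁≢a₂ ∘ sym
  A-vertex-other-than (no a₁≢v)  = a₁ , a₁∈A , a₁≢v

  B-vertex-other-than : ∀ {v} → Dec (b₁ ≡ v) → ∃[ b ] A b ≡ false × b ≢ v
  B-vertex-other-than (yes refl) = b₂ , b₂∈B , b₁≢b₂ ∘ sym
  B-vertex-other-than (no b₁≢v)  = b₁ , b₁∈B , b₁≢v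

swap-sides : {G : Graph} → (∀ {u v} → Adj G u v → Adj G v u) → Split G → Split G
swap-sides adj-sym S = record
  { A = not ∘ A ; A' = B' ; B' = A'
  ; a₁ = b₁ ; a₂ = b₂ ; b₁ = a₁ ; b₂ = a₂
  ; a₁≢a₂ = b₁≢b₂ ; b₁≢b₂ = a₁≢a₂
  ; a₁∈A = cong not b₁∈B ; a₂∈A = cong not b₂∈B
  ; b₁∈B = cong not a₁∈A ; b₂∈B = cong not a₂∈A
  ; A'⊆A = λ v → cong not ∘ B'⊆B v
  ; B'⊆B = λ v → cong not ∘ A'⊆A v
  ; cross = λ b a b∉A a∉B →
      let a∈A = not-injective {y = true} a∉B
          b∈B = not-injective {y = false} b∉A
      in mk⇔ (swap ∘ cut-edge S a∈A b∈B ∘ adj-sym) (λ (b∈B' , a∈A') → adj-sym (complete S a∈A' b∈B'))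
  }
  where open Split S

module Theta {m : ℕ} (ℓ : Fin m → ℕ) (ℓ≥1 : ∀ i → 1 ≤ ℓ i) where

  Vertex : Set
  Vertex = ThetaV m ℓ

  Adjacent : Vertex → Vertex → Set
  Adjacent = ThetaAdj m ℓ

  adjacent-sym : ∀ {u v} → Adjacent u v → Adjacent v u
  adjacent-sym (i , p , inj₁ on) = i , p , inj₂ on
  adjacent-sym (i , p , inj₂ on) = i , p , inj₁ on

  private
    <∸1⇒suc< : ∀ {k n} → k < n ∸ 1 → suc k < n
    <∸1⇒suc< {n = suc n} k<n = s≤s k<n

    suc<⇒<∸1 : ∀ {k n} → suc k < n → k < n ∸ 1
    suc<⇒<∸1 {n = suc n} (s≤s k<n) = k<n

    suc<⇒≤ : ∀ {k n} → suc k < n → k ≤ n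
    suc<⇒≤ k+1<n = ≤-trans (n≤1+n _) (<⇒≤ k+1<n)

  -- path i k is the vertex at distance k from x on the i-th path (and y beyond its end).
  path : Fin m → ℕ → Vertex
  path i zero = vx
  path i (suc k) with k <? ℓ i ∸ 1
  ... | yes k<ℓ-1 = inner i (fromℕ< k<ℓ-1)
  ... | no _      = vy

  path-inner : ∀ {i} (f : Fin (ℓ i ∸ 1)) → path i (suc (toℕ f)) ≡ inner i f
  path-inner {i} f with toℕ f <? ℓ i ∸ 1
  ... | yes f<ℓ-1 = cong (inner i) (fromℕ<-toℕ f f<ℓ-1)
  ... | no  f≮ℓ-1 = contradiction (toℕ<n f) f≮ℓ-1

  path-interior : ∀ {i k} → suc k < ℓ i → ∃[ f ] toℕ f ≡ k × path i (suc k) ≡ inner i f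
  path-interior {i} {k} k+1<ℓ with k <? ℓ i ∸ 1
  ... | yes k<ℓ-1 = fromℕ< k<ℓ-1 , toℕ-fromℕ< k<ℓ-1 , refl
  ... | no  k≮ℓ-1 = contradiction (suc<⇒<∸1 k+1<ℓ) k≮ℓ-1

  path-end : ∀ i → path i (ℓ i) ≡ vy
  path-end i with ℓ i in ℓi≡ | ℓ≥1 i
  ... | suc n | _ with n <? ℓ i ∸ 1
  ...   | yes n<ℓ-1 = contradiction (subst (λ l → n < l ∸ 1) ℓi≡ n<ℓ-1) (n≮n n)
  ...   | no _      = refl

  path-onPath : ∀ {i k} → k ≤ ℓ i → OnPath i (path i k) k
  path-onPath {k = zero} _ = onx
  path-onPath {i} {suc k} k+1≤ℓ with k <? ℓ i ∸ 1
  ... | yes k<ℓ-1 = subst (OnPath i (inner i (fromℕ< k<ℓ-1)) ∘ suc) (toℕ-fromℕ< k<ℓ-1) (oninner (fromℕ< k<ℓ-1))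
  ... | no  k≮ℓ-1 = subst (OnPath i vy) (≤-antisym (≮⇒≥ (k≮ℓ-1 ∘ suc<⇒<∸1)) k+1≤ℓ) ony

  onPath⇒path : ∀ {i v k} → OnPath i v k → k ≤ ℓ i × path i k ≡ v
  onPath⇒path onx          = z≤n , refl
  onPath⇒path {i} ony      = ≤-refl , path-end i
  onPath⇒path (oninner f)  = <⇒≤ (<∸1⇒suc< (toℕ<n f)) , path-inner f

  path-adjacent : ∀ {i k} → k < ℓ i → Adjacent (path i k) (path i (suc k))
  path-adjacent {i} {k} k<ℓ = i , k , inj₁ (path-onPath (<⇒≤ k<ℓ) , path-onPath k<ℓ)

  path-injective : ∀ {i a b} → a ≤ ℓ i → b ≤ ℓ i → path i a ≡ path i b → a ≡ b
  path-injective a≤ℓ b≤ℓ eq = onPath-injective (path-onPath a≤ℓ) (subst (λ v → OnPath _ v _) (sym eq) (path-onPath b≤ℓ))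
    where
    onPath-injective : ∀ {i v a b} → OnPath {m} {ℓ} i v a → OnPath i v b → a ≡ b
    onPath-injective onx         onx          = refl
    onPath-injective ony         ony          = refl
    onPath-injective (oninner f) (oninner .f) = refl

  paths-meet-at-ends : ∀ {i j a b} → i ≢ j → a ≤ ℓ i → b ≤ ℓ j → path i a ≡ path j b →
                       (a ≡ 0 × b ≡ 0) ⊎ (a ≡ ℓ i × b ≡ ℓ j)
  paths-meet-at-ends {i} {j} i≢j a≤ℓ b≤ℓ eq = onPaths (path-onPath a≤ℓ) (subst (λ v → OnPath _ v _) (sym eq) (path-onPath b≤ℓ))
    where
    onPaths : ∀ {v a b} → OnPath {m} {ℓ} i v a → OnPath j v b → (a ≡ 0 × b ≡ 0) ⊎ (a ≡ ℓ i × b ≡ ℓ j)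
    onPaths onx         onx         = inj₁ (refl , refl)
    onPaths ony         ony         = inj₂ (refl , refl)
    onPaths (oninner f) (oninner g) = contradiction refl i≢j

  neighbour-of-inner : ∀ {u i} {f : Fin (ℓ i ∸ 1)} → Adjacent u (inner i f) →
                       OnPath i u (toℕ f) ⊎ OnPath i u (2 + toℕ f)
  neighbour-of-inner (_ , _ , inj₁ (u-on , oninner f)) = inj₁ u-on
  neighbour-of-inner (_ , _ , inj₂ (oninner f , u-on)) = inj₂ u-on

  neighbour-of-interior : ∀ {u i k} → suc k < ℓ i → Adjacent u (path i (suc k)) →
                          u ≡ path i k ⊎ u ≡ path i (2 + k)
  neighbour-of-interior {u} k+1<ℓ adj with path-interior k+1<ℓ
  ... | f , refl , eq = Sum.map on⇒≡ on⇒≡ (neighbour-of-inner (subst (Adjacent u) eq adj))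
    where
    on⇒≡ : ∀ {i k} → OnPath i u k → u ≡ path i k
    on⇒≡ = sym ∘ proj₂ ∘ onPath⇒path

  interior-adjacent-same-path : ∀ {i c k} → c ≤ ℓ i → suc k < ℓ i →
                                Adjacent (path i c) (path i (suc k)) → c ≡ k ⊎ c ≡ 2 + k
  interior-adjacent-same-path c≤ℓ k+1<ℓ adj =
    Sum.map (path-injective c≤ℓ (suc<⇒≤ k+1<ℓ)) (path-injective c≤ℓ k+1<ℓ) (neighbour-of-interior k+1<ℓ adj)

  interior-adjacent-other-path : ∀ {i j c k} → j ≢ i → c ≤ ℓ j → suc k < ℓ i →
                                 Adjacent (path j c) (path i (suc k)) →
                                 (c ≡ 0 × k ≡ 0) ⊎ (c ≡ ℓ j × 2 + k ≡ ℓ i)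
  interior-adjacent-other-path j≢i c≤ℓ k+1<ℓ adj with neighbour-of-interior k+1<ℓ adj
  ... | inj₁ eq with paths-meet-at-ends j≢i c≤ℓ (suc<⇒≤ k+1<ℓ) eq
  ...   | inj₁ at-x         = inj₁ at-x
  ...   | inj₂ (_ , refl)   = contradiction k+1<ℓ (<-asym (n<1+n _))
  interior-adjacent-other-path j≢i c≤ℓ k+1<ℓ adj | inj₂ eq with paths-meet-at-ends j≢i c≤ℓ k+1<ℓ eq
  ...   | inj₁ (_ , ())
  ...   | inj₂ at-y = inj₂ at-y

  x-adjacent-interior : ∀ {i k} → suc k < ℓ i → Adjacent vx (path i (suc k)) → k ≡ 0
  x-adjacent-interior k+1<ℓ adj with interior-adjacent-same-path z≤n k+1<ℓ adj
  ... | inj₁ 0≡k = sym 0≡k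

  y-adjacent-interior : ∀ {i k} → suc k < ℓ i → Adjacent (path i (suc k)) vy → 2 + k ≡ ℓ i
  y-adjacent-interior {i} {k} k+1<ℓ adj
    with interior-adjacent-same-path ≤-refl k+1<ℓ (subst (λ v → Adjacent v (path i (suc k))) (sym (path-end i)) (adjacent-sym adj))
  ... | inj₁ refl = contradiction k+1<ℓ (<-asym (n<1+n _))
  ... | inj₂ ℓ≡2+k = sym ℓ≡2+k

  interior-vertex : ∀ {v} → v ≢ vx → v ≢ vy → ∃₂ λ i s → suc s < ℓ i × path i (suc s) ≡ v
  interior-vertex {vx}        v≢x _ = contradiction refl v≢x
  interior-vertex {vy}        _ v≢y = contradiction refl v≢y
  interior-vertex {inner i f} _ _   = i , toℕ f , <∸1⇒suc< (toℕ<n f) , path-inner f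

  _≟vx : (v : Vertex) → Dec (v ≡ vx)
  vx        ≟vx = yes refl
  vy        ≟vx = no λ ()
  inner _ _ ≟vx = no λ ()

  _≟vy : (v : Vertex) → Dec (v ≡ vy)
  vx        ≟vy = no λ ()
  vy        ≟vy = yes refl
  inner _ _ ≟vy = no λ ()

  interior-twins : ∀ {i j s t} → suc s < ℓ i → suc t < ℓ j → path i (suc s) ≢ path j (suc t) →
                   Adjacent (path i s) (path j (suc t)) → Adjacent (path i (2 + s)) (path j (suc t)) →
                   i ≢ j × ℓ i ≡ 2 × ℓ j ≡ 2
  interior-twins {i} {j} {s} {t} s+1<ℓ t+1<ℓ distinct adj₀ adj₂ with i ≟ᶠ j
  ... | yes refl = contradiction (cong (path i ∘ suc) s≡t) distinct
    where
    s≡t : s ≡ t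
    s≡t with interior-adjacent-same-path (suc<⇒≤ s+1<ℓ) t+1<ℓ adj₀ | interior-adjacent-same-path s+1<ℓ t+1<ℓ adj₂
    ... | inj₁ s≡t    | _               = s≡t
    ... | _           | inj₂ 2+s≡2+t    = +-cancelˡ-≡ 2 s t 2+s≡2+t
    ... | inj₂ refl   | inj₁ 4+t≡t      = contradiction (sym 4+t≡t) (m≢1+n+m t)
  ... | no i≢j with interior-adjacent-other-path i≢j (suc<⇒≤ s+1<ℓ) t+1<ℓ adj₀
  ...   | inj₂ (refl , _) = contradiction s+1<ℓ (<-asym (n<1+n _))
  ...   | inj₁ (refl , refl) with interior-adjacent-other-path i≢j s+1<ℓ t+1<ℓ adj₂
  ...     | inj₁ (() , _)
  ...     | inj₂ (2≡ℓi , 2≡ℓj) = i≢j , sym 2≡ℓi , sym 2≡ℓj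

  middle? : Vertex → Bool
  middle? vx          = false
  middle? vy          = false
  middle? (inner k _) = ℓ k ≡ᵇ 2

  end? : Vertex → Bool
  end? vx          = true
  end? vy          = true
  end? (inner _ _) = false

  middle-neighbours : ∀ {k} → ℓ k ≡ 2 → (f : Fin (ℓ k ∸ 1)) → ∀ v → Adjacent (inner k f) v ⇔ end? v ≡ true
  middle-neighbours {k} ℓ≡2 f v = mk⇔ to (from v)
    where
    1<ℓ : 1 < ℓ k
    1<ℓ = subst (1 <_) (sym ℓ≡2) (n<1+n 1)

    middle≡ : inner k f ≡ path k 1
    middle≡ = trans (sym (path-inner f)) (cong (path k ∘ suc) (n<1⇒n≡0 (subst (λ l → toℕ f < l ∸ 1) ℓ≡2 (toℕ<n f))))

    path-2 : path k 2 ≡ vy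
    path-2 = subst (λ l → path k l ≡ vy) ℓ≡2 (path-end k)

    to : Adjacent (inner k f) v → end? v ≡ true
    to adj with neighbour-of-interior 1<ℓ (subst (Adjacent v) middle≡ (adjacent-sym adj))
    ... | inj₁ refl = refl
    ... | inj₂ refl = cong end? path-2

    from : ∀ v → end? v ≡ true → Adjacent (inner k f) v
    from vx _ = subst (λ u → Adjacent u vx) (sym middle≡) (adjacent-sym (path-adjacent (<-trans (n<1+n 0) 1<ℓ)))
    from vy _ = subst₂ Adjacent (sym middle≡) path-2 (path-adjacent 1<ℓ)

  middles-split : ∀ {i j} → i ≢ j → ℓ i ≡ 2 → ℓ j ≡ 2 → Split (θ m ℓ)
  middles-split {i} {j} i≢j ℓi≡2 ℓj≡2 = record
    { A = middle? ; A' = middle? ; B' = end?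
    ; a₁ = inner i (middle ℓi≡2) ; a₂ = inner j (middle ℓj≡2) ; b₁ = vx ; b₂ = vy
    ; a₁≢a₂ = i≢j ∘ inner-injective ; b₁≢b₂ = λ ()
    ; a₁∈A = Equivalence.to T-≡ (≡⇒≡ᵇ (ℓ i) 2 ℓi≡2) ; a₂∈A = Equivalence.to T-≡ (≡⇒≡ᵇ (ℓ j) 2 ℓj≡2)
    ; b₁∈B = refl ; b₂∈B = refl
    ; A'⊆A = λ _ a∈A → a∈A
    ; B'⊆B = λ { vx _ → refl ; vy _ → refl ; (inner _ _) () }
    ; cross = cross
    }
    where
    middle : ∀ {k} → ℓ k ≡ 2 → Fin (ℓ k ∸ 1)
    middle ℓ≡2 = subst (λ l → Fin (l ∸ 1)) (sym ℓ≡2) fzero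

    inner-injective : ∀ {k k' f g} → inner {m} {ℓ} k f ≡ inner k' g → k ≡ k'
    inner-injective refl = refl

    cross : ∀ a b → middle? a ≡ true → middle? b ≡ false → Adjacent a b ⇔ (middle? a ≡ true × end? b ≡ true)
    cross (inner k f) b a∈A _ = mk⇔ (λ adj → a∈A , to adj) (from ∘ proj₂)
      where open Equivalence (middle-neighbours (≡ᵇ⇒≡ (ℓ k) 2 (Equivalence.from T-≡ a∈A)) f b)

  crossing : (S : Split (θ m ℓ)) → let open Split S in
             ∀ {i p q} → p ≤ q → q ≤ ℓ i → A (path i p) ≡ true → A (path i q) ≡ false →
             ∃[ k ] p ≤ k × k < q × A' (path i k) ≡ true × B' (path i (suc k)) ≡ true
  crossing S {i} p≤q q≤ℓ Ap Aq with falling-edge (Split.A S ∘ path i) p≤q Ap Aq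
  ... | k , p≤k , k<q , Ak , Ak+1 = k , p≤k , k<q , cut-edge S Ak Ak+1 (path-adjacent (≤-trans k<q q≤ℓ))

  module _ (S : Split (θ m ℓ)) where
    open Split S

    interior-B-vertex-neighbours : A vx ≡ true → A vy ≡ true → ∀ {i s} → suc s < ℓ i → A (path i (suc s)) ≡ false →
                                   A' (path i s) ≡ true × B' (path i (suc s)) ≡ true × A' (path i (2 + s)) ≡ true
    -- The last cut edge before the vertex and the first one after it are joined by an edge,
    -- which on a path forces both to be the edges at the vertex itself.
    interior-B-vertex-neighbours Ax Ay {i} {s} s+1<ℓ As+1
      with crossing S z≤n (<⇒≤ s+1<ℓ) Ax As+1
         | crossing (swap-sides adjacent-sym S) (<⇒≤ s+1<ℓ) ≤-refl
                    (cong not As+1) (cong not (trans (cong A (path-end i)) Ay))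
    ... | r , _ , r<s+1 , Ar , Br+1 | suc t , s≤s s≤t , t+1<ℓ , Bt+1 , At+2
      with interior-adjacent-same-path (≤-trans (<⇒≤ r<s+1) (<⇒≤ s+1<ℓ)) t+1<ℓ (complete S Ar Bt+1)
    ...   | inj₂ refl = contradiction (≤-trans (≤-pred r<s+1) s≤t) (<⇒≱ (m<n⇒m<1+n (n<1+n t)))
    ...   | inj₁ refl with ≤-antisym (≤-pred r<s+1) s≤t
    ...     | refl = Ar , Br+1 , At+2

    both-ends-in-A : A vx ≡ true → A vy ≡ true → AtMostOne (λ i → ℓ i ≡ 2) → ⊥
    both-ends-in-A Ax Ay atMostOne
      with interior-vertex (≢-sym (different-sides S Ax b₁∈B)) (≢-sym (different-sides S Ay b₁∈B))
         | interior-vertex (≢-sym (different-sides S Ax b₂∈B)) (≢-sym (different-sides S Ay b₂∈B))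
    ... | i , s , s+1<ℓ , b₁≡ | j , t , t+1<ℓ , b₂≡
      with interior-B-vertex-neighbours Ax Ay s+1<ℓ (trans (cong A b₁≡) b₁∈B)
         | interior-B-vertex-neighbours Ax Ay t+1<ℓ (trans (cong A b₂≡) b₂∈B)
    ...   | As , _ , As+2 | _ , Bt+1 , _
      with interior-twins s+1<ℓ t+1<ℓ (λ eq → b₁≢b₂ (trans (sym b₁≡) (trans eq b₂≡)))
                          (complete S As Bt+1) (complete S As+2 Bt+1)
    ...     | i≢j , ℓi≡2 , ℓj≡2 = atMostOne i≢j ℓi≡2 ℓj≡2

    other-paths-are-edges : A vx ≡ true → A vy ≡ false → ∀ {i s t} → suc s < ℓ i → suc t < ℓ i →
                            A' (path i (suc s)) ≡ true → B' (path i (suc t)) ≡ true →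
                            ∀ {j} → j ≢ i → ℓ j ≡ 1 × A' vx ≡ true × B' vy ≡ true
    other-paths-are-edges Ax Ay s+1<ℓ t+1<ℓ As+1 Bt+1 {j} j≢i
      with crossing S z≤n ≤-refl Ax (trans (cong A (path-end j)) Ay)
    ... | c , _ , c<ℓ , Ac , Bc+1
      with interior-adjacent-other-path j≢i (<⇒≤ c<ℓ) t+1<ℓ (complete S Ac Bt+1)
         | interior-adjacent-other-path j≢i c<ℓ s+1<ℓ (adjacent-sym (complete S As+1 Bc+1))
    ...   | inj₂ (refl , _) | _                = contradiction c<ℓ (n≮n c)
    ...   | inj₁ (refl , _) | inj₁ (() , _)
    ...   | inj₁ (refl , _) | inj₂ (1≡ℓj , _) =
            sym 1≡ℓj , Ac , subst (λ v → B' v ≡ true) (trans (cong (path j) 1≡ℓj) (path-end j)) Bc+1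

    single-path-of-length-3 : A vx ≡ true → A vy ≡ false → 2 ≤ m → ∀ {i k k'} → suc k < ℓ i → suc k' < ℓ i →
                              A' (path i (suc k)) ≡ true → B' (path i (2 + k)) ≡ true →
                              A' (path i k') ≡ true → B' (path i (suc k')) ≡ true →
                              ℓ i ≡ 3 × (∀ j → j ≢ i → ℓ j ≡ 1)
    single-path-of-length-3 Ax Ay 2≤m {i} {k} {k'} k+1<ℓ k'+1<ℓ Ak+1 Bk+2 Ak' Bk'+1 =
      ℓ≡3 k' (interior-adjacent-same-path (<⇒≤ k+1<ℓ) k'+1<ℓ (complete S Ak+1 Bk'+1)) (k'≡0 k' k'+1<ℓ Ak') ,
      λ j → proj₁ ∘ edge
      where
      edge = other-paths-are-edges Ax Ay k+1<ℓ k'+1<ℓ Ak+1 Bk'+1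
      ends = proj₂ (edge (proj₂ (other-index 2≤m i)))

      2+k≡ℓ : 2 + k ≡ ℓ i
      2+k≡ℓ with m≤n⇒m<n∨m≡n k+1<ℓ
      ... | inj₂ 2+k≡ℓ = 2+k≡ℓ
      ... | inj₁ 2+k<ℓ with () ← x-adjacent-interior 2+k<ℓ (complete S (proj₁ ends) Bk+2)

      k'≡0 : ∀ k' → suc k' < ℓ i → A' (path i k') ≡ true → k' ≡ 0
      k'≡0 zero     _        _   = refl
      k'≡0 (suc k'') k'+1<ℓ Ak' =
        contradiction (y-adjacent-interior (<⇒≤ k'+1<ℓ) (complete S Ak' (proj₂ ends))) (<⇒≢ k'+1<ℓ)

      ℓ≡3 : ∀ k' → suc k ≡ k' ⊎ suc k ≡ 2 + k' → k' ≡ 0 → ℓ i ≡ 3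
      ℓ≡3 _ (inj₂ refl) refl = sym 2+k≡ℓ

    separated-ends⇒single-path-of-length-3 : A vx ≡ true → A vy ≡ false → 2 ≤ m →
                                             ∃[ i ] ℓ i ≡ 3 × (∀ j → j ≢ i → ℓ j ≡ 1)
    separated-ends⇒single-path-of-length-3 Ax Ay 2≤m
      with A-vertex-other-than S (a₁ ≟vx) | B-vertex-other-than S (b₁ ≟vy)
    ... | a , Aa , a≢x | b , Ab , b≢y
      with interior-vertex a≢x (different-sides S Aa Ay) | interior-vertex (≢-sym (different-sides S Ax Ab)) b≢y
    ...   | i , p , p+1<ℓ , refl | i' , q , q+1<ℓ , refl
      with crossing S (<⇒≤ p+1<ℓ) ≤-refl Aa (trans (cong A (path-end i)) Ay) | crossing S z≤n (<⇒≤ q+1<ℓ) Ax Ab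
    ...     | suc k , s≤s _ , k+1<ℓ , Ak+1 , Bk+2 | k' , _ , k'<q+1 , Ak' , Bk'+1
      with i ≟ᶠ i' | ≤-trans (s≤s k'<q+1) q+1<ℓ
    ...       | yes refl | k'+1<ℓ = i , single-path-of-length-3 Ax Ay 2≤m k+1<ℓ k'+1<ℓ Ak+1 Bk+2 Ak' Bk'+1
    ...       | no i≢i'  | k'+1<ℓ
      with interior-adjacent-other-path i≢i' (<⇒≤ k+1<ℓ) k'+1<ℓ (complete S Ak+1 Bk'+1)
    ...         | inj₁ (() , _)
    ...         | inj₂ (k+1≡ℓ , _) = contradiction k+1≡ℓ (<⇒≢ k+1<ℓ)

  thetaOrder-one-path : ∀ i → (∀ j → j ≢ i → ℓ j ≡ 1) → thetaOrder m ℓ ≡ 2 + (ℓ i ∸ 1)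
  thetaOrder-one-path i others≡1 = cong (2 +_) (begin
    sum (map (λ j → ℓ j ∸ 1) (allFin m))  ≡⟨ cong sum (map-tabulate (λ j → j) (λ j → ℓ j ∸ 1)) ⟩
    sum (tabulate (λ j → ℓ j ∸ 1))        ≡⟨ sum-tabulate-single (λ j → ℓ j ∸ 1) i (λ j j≢i → cong (_∸ 1) (others≡1 j j≢i)) ⟩
    ℓ i ∸ 1                               ∎)
    where open ≡-Reasoning

  no-split-with-x-in-A : 2 ≤ m → 5 ≤ thetaOrder m ℓ → AtMostOne (λ i → ℓ i ≡ 2) →
                         (S : Split (θ m ℓ)) → Split.A S vx ≡ true → ⊥
  no-split-with-x-in-A 2≤m 5≤n atMostOne S Ax with Split.A S vy in Ay
  ... | true  = both-ends-in-A S Ax Ay atMostOne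
  ... | false with separated-ends⇒single-path-of-length-3 S Ax Ay 2≤m
  ...   | i , ℓi≡3 , others≡1 =
          1+n≰n (subst (5 ≤_) (trans (thetaOrder-one-path i others≡1) (cong (λ l → 2 + (l ∸ 1)) ℓi≡3)) 5≤n)

  prime : 2 ≤ m → 5 ≤ thetaOrder m ℓ → AtMostOne (λ i → ℓ i ≡ 2) → Prime (θ m ℓ)
  prime 2≤m 5≤n atMostOne S with Split.A S vx in Ax
  ... | true  = no-split-with-x-in-A 2≤m 5≤n atMostOne S Ax
  ... | false = no-split-with-x-in-A 2≤m 5≤n atMostOne (swap-sides adjacent-sym S) (cong not Ax)

proposition6p2 : (m : ℕ) → 2 ≤ m → (ℓ : Fin m → ℕ) → (∀ i → 1 ≤ ℓ i) →
    countEq m ℓ 1 ≤ 1 → 5 ≤ thetaOrder m ℓ →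
    Prime (θ m ℓ) ⇔ (countEq m ℓ 2 ≤ 1)
proposition6p2 m 2≤m ℓ ℓ≥1 _ 5≤n =
  mk⇔ (λ is-prime → from λ i≢j ℓi≡2 ℓj≡2 → is-prime (middles-split i≢j ℓi≡2 ℓj≡2))
      (prime 2≤m 5≤n ∘ to)
  where
  open Theta ℓ ℓ≥1
  open Equivalence (count-allFin≤1⇔ (λ i → ℓ i ≟ 2))
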